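{- Let $\mathcal{F}\subseteq\{0',1,{}^{ -1},{}^{c},\pi,\bar\pi,-,/,\backslash\}$, let $G$ be a structure and $k$ a natural number. For every expression $e\in\mathcal{C}(\mathcal{F})_k$ we have $e(G)\subseteq\mathrm{paths}^{\mathcal{F}}_k(G)$.
   Context: Fix a finite set $\Lambda$ of relation names. A structure is $G=(V,(R^G)_{R\in\Lambda})$ with each $R^G\subseteq V\times V$. Expressions are built from relation names and constants $0,1,0',1'$ using $\cup,\cap,\circ,-,/,\backslash,{}^c,{}^{ -1},\pi_1,\pi_2,\bar\pi_1,\bar\pi_2$, with semantics on $G$ (node set $V$): $R(G)=R^G$, $0(G)=\emptyset$, $1(G)=V^2$, $0'(G)=\{(s,t)\in V^2:s\ne t\}$, $1'(G)=\{(s,s):s\in V\}$; set operations for $\cup,\cap,-$; $e^c(G)=V^2\setminus e(G)$; $(e_1\circ e_2)(G)=\{(s,t):\exists v\,((s,v)\in e_1(G)\wedge(v,t)\in e_2(G))\}$; $e^{ -1}(G)=\{(s,t):(t,s)\in e(G)\}$; $\pi_1(e)(G)=\{(s,s):\exists t\,(s,t)\in e(G)\}$, $\pi_2(e)(G)=\{(s,s):\exists t\,(t,s)\in e(G)\}$; $\bar\pi_1(e)(G)=\{(s,s):s\in V,\neg\exists t\,(s,t)\in e(G)\}$, $\bar\pi_2(e)(G)=\{(s,s):s\in V,\neg\exists t\,(t,s)\in e(G)\}$; $(e_1/e_2)(G)=\{(s,t)\in V^2:\forall v((t,v)\in e_2(G)\to(s,v)\in e_1(G))\}$; $(e_1\backslash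 e_2)(G)=\{(s,t)\in V^2:\forall v((v,s)\in e_1(G)\to(v,t)\in e_2(G))\}$. $\mathcal{C}(\mathcal{F})$: expressions built from relation names, $0$, $1'$, constants in $\mathcal{F}$ using $\circ,\cup,\cap$ and operations in $\mathcal{F}$ ($\pi$ = both projections, $\bar\pi$ = both coprojections). Degree: relation names/constants $0$; $\cup,\cap,-$: max; ${}^c,{}^{ -1}$: unchanged; $\circ,/,\backslash$: $1+\max$; $\pi_i,\bar\pi_i$: $+1$. $\mathcal{C}(\mathcal{F})_k$: expressions of $\mathcal{C}(\mathcal{F})$ of degree $\le k$. $\mathrm{paths}^{\mathcal{F}}_k(G)$: let $E_G=\bigcup_R R^G$; $\mathrm{paths}_k(G)$ = pairs $(x,y)\in V^2$ joined by a directed path of length $\le 2^k$ in $(V,E_G)$ (length $0$ allowed), $\mathrm{upaths}_k(G)$ = same in the undirected graph with edges $\{x,y\}$ for $(x,y)\in E_G$. 1 is present at degree 0 if $\mathcal{F}$ contains $1,0'$ or ${}^c$; at degree 1 if not at degree 0 and $\mathcal{F}$ contains $/$ or $\backslash$; absent otherwise. If absent: $\mathrm{paths}^{\mathcal{F}}_k(G)=\mathrm{paths}_k(G)$ if ${}^{ -1}\notin\mathcal{F}$, $=\mathrm{upaths}_k(G)$ if ${}^{ -1}\in\mathcal{F}$; if at degree 1: as in the absent case for $k=0$, $V^2$ for $k>0$; if at degree 0: $V^2$ for all $k$. -}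

module Defs where

open import Data.Nat using (ℕ; zero; suc; _≤_; _^_; _⊔_)
open import Data.Fin using (Fin)
open import Data.Bool using (Bool; true; false; T; _∨_; if_then_else_)
open import Data.Product using (Σ; ∃; _×_; _,_)
open import Data.Sum using (_⊎_)
open import Data.Unit using (⊤)
open import Data.Empty using (⊥)
open import Relation.Nullary using (¬_)
open import Relation.Binary.PropositionalEquality using (_≡_)

record Structure (m : ℕ) : Set₁ where
  field
    V   : Set
    rel : Fin m → V → V → Set

Rel₂ : Set → Set₁
Rel₂ V = V → V → Set

data Expr (m : ℕ) : Set where
  name  : Fin m → Expr m
  c0    : Expr m
  c1    : Expr m
  c0'   : Expr m
  c1'   : Expr m
  _∪ₑ_  : Expr m → Expr m → Expr m
  _∩ₑ_  : Expr m → Expr m → Expr m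
  _∘ₑ_  : Expr m → Expr m → Expr m
  _-ₑ_  : Expr m → Expr m → Expr m
  _/ₑ_  : Expr m → Expr m → Expr m
  _⧵ₑ_  : Expr m → Expr m → Expr m
  compl : Expr m → Expr m
  conv  : Expr m → Expr m
  π₁ₑ   : Expr m → Expr m
  π₂ₑ   : Expr m → Expr m
  π̄₁ₑ   : Expr m → Expr m
  π̄₂ₑ   : Expr m → Expr m

module _ {m : ℕ} (G : Structure m) where
  open Structure G

  ⟦_⟧ : Expr m → Rel₂ V
  ⟦ name R ⟧ s t = rel R s t
  ⟦ c0 ⟧ s t = ⊥
  ⟦ c1 ⟧ s t = ⊤
  ⟦ c0' ⟧ s t = ¬ (s ≡ t)
  ⟦ c1' ⟧ s t = s ≡ t
  ⟦ e₁ ∪ₑ e₂ ⟧ s t = ⟦ e₁ ⟧ s t ⊎ ⟦ e₂ ⟧ s t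
  ⟦ e₁ ∩ₑ e₂ ⟧ s t = ⟦ e₁ ⟧ s t × ⟦ e₂ ⟧ s t
  ⟦ e₁ ∘ₑ e₂ ⟧ s t = ∃ λ v → ⟦ e₁ ⟧ s v × ⟦ e₂ ⟧ v t
  ⟦ e₁ -ₑ e₂ ⟧ s t = ⟦ e₁ ⟧ s t × ¬ ⟦ e₂ ⟧ s t
  ⟦ e₁ /ₑ e₂ ⟧ s t = ∀ v → ⟦ e₂ ⟧ t v → ⟦ e₁ ⟧ s v
  ⟦ e₁ ⧵ₑ e₂ ⟧ s t = ∀ v → ⟦ e₁ ⟧ v s → ⟦ e₂ ⟧ v t
  ⟦ compl e ⟧ s t = ¬ ⟦ e ⟧ s t
  ⟦ conv e ⟧ s t = ⟦ e ⟧ t s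
  ⟦ π₁ₑ e ⟧ s t = s ≡ t × ∃ λ u → ⟦ e ⟧ s u
  ⟦ π₂ₑ e ⟧ s t = s ≡ t × ∃ λ u → ⟦ e ⟧ u s
  ⟦ π̄₁ₑ e ⟧ s t = s ≡ t × ¬ (∃ λ u → ⟦ e ⟧ s u)
  ⟦ π̄₂ₑ e ⟧ s t = s ≡ t × ¬ (∃ λ u → ⟦ e ⟧ u s)

degree : ∀ {m} → Expr m → ℕ
degree (name _) = 0
degree c0 = 0
degree c1 = 0
degree c0' = 0
degree c1' = 0
degree (e₁ ∪ₑ e₂) = degree e₁ ⊔ degree e₂
degree (e₁ ∩ₑ e₂) = degree e₁ ⊔ degree e₂
degree (e₁ -ₑ e₂) = degree e₁ ⊔ degree e₂
degree (e₁ ∘ₑ e₂) = suc (degree e₁ ⊔ degree e₂)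
degree (e₁ /ₑ e₂) = suc (degree e₁ ⊔ degree e₂)
degree (e₁ ⧵ₑ e₂) = suc (degree e₁ ⊔ degree e₂)
degree (compl e) = degree e
degree (conv e) = degree e
degree (π₁ₑ e) = suc (degree e)
degree (π₂ₑ e) = suc (degree e)
degree (π̄₁ₑ e) = suc (degree e)
degree (π̄₂ₑ e) = suc (degree e)

record Fragment : Set where
  field
    has0'    : Bool
    has1     : Bool
    hasConv  : Bool
    hasCompl : Bool
    hasπ     : Bool   -- both projections
    hasπ̄     : Bool   -- both coprojections
    hasDiff  : Bool
    hasSlash : Bool
    hasBacksl : Bool

module _ (F : Fragment) where
  open Fragment F

  InC : ∀ {m} → Expr m → Set
  InC (name _) = ⊤
  InC c0 = ⊤
  InC c1 = T has1
  InC c0' = T has0'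
  InC c1' = ⊤
  InC (e₁ ∪ₑ e₂) = InC e₁ × InC e₂
  InC (e₁ ∩ₑ e₂) = InC e₁ × InC e₂
  InC (e₁ ∘ₑ e₂) = InC e₁ × InC e₂
  InC (e₁ -ₑ e₂) = T hasDiff × InC e₁ × InC e₂
  InC (e₁ /ₑ e₂) = T hasSlash × InC e₁ × InC e₂
  InC (e₁ ⧵ₑ e₂) = T hasBacksl × InC e₁ × InC e₂
  InC (compl e) = T hasCompl × InC e
  InC (conv e) = T hasConv × InC e
  InC (π₁ₑ e) = T hasπ × InC e
  InC (π₂ₑ e) = T hasπ × InC e
  InC (π̄₁ₑ e) = T hasπ̄ × InC e
  InC (π̄₂ₑ e) = T hasπ̄ × InC e

data Walk {V : Set} (E : Rel₂ V) : ℕ → V → V → Set where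
  [] : ∀ {x} → Walk E 0 x x
  _∷_ : ∀ {n x y z} → E x y → Walk E n y z → Walk E (suc n) x z

WithinDist : {V : Set} → Rel₂ V → ℕ → Rel₂ V
WithinDist E k x y = ∃ λ n → n ≤ 2 ^ k × Walk E n x y

module _ {m : ℕ} (G : Structure m) where
  open Structure G

  edges : Rel₂ V
  edges x y = ∃ λ (R : Fin m) → rel R x y

  uedges : Rel₂ V
  uedges x y = edges x y ⊎ edges y x

  paths : ℕ → Rel₂ V
  paths k = WithinDist edges k

  upaths : ℕ → Rel₂ V
  upaths k = WithinDist uedges k

  full : Rel₂ V
  full _ _ = ⊤

  pathsF : Fragment → ℕ → Rel₂ V
  pathsF F k =
    if has1 ∨ has0' ∨ hasCompl then full          -- 1 present at degree 0
    else if hasSlash ∨ hasBacksl then              -- 1 present at degree 1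
      (case-k k)
    else absent k
    where
      open Fragment F
      absent : ℕ → Rel₂ V
      absent j = if hasConv then upaths j else paths j
      case-k : ℕ → Rel₂ V
      case-k zero = absent zero
      case-k (suc _) = full

-- Without 1, 0' and complement, every operation either stays inside its
-- arguments (∪, ∩, −, and converse once the edges are symmetrised), lands on
-- the diagonal (projections, coprojections, 1'), or, for composition, glues two
-- paths of length ≤ 2^k into one of length ≤ 2^(k+1); so induction on e gives
-- paths of length ≤ 2^(degree e).  Residuals have degree ≥ 1 and can produce the
-- full relation, which is why their presence only matters from k = 1 on.
module Submission where

open import Defs
open import Data.Nat using (ℕ; zero; suc; _≤_; _+_; _^_; z≤n; s≤s)
open import Data.Nat.Properties using (≤-trans; m≤m⊔n; m≤n⊔m; m≤m+n; +-mono-≤; ^-monoʳ-≤)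
open import Data.Bool using (true; false; T; _∨_; if_then_else_)
open import Data.Bool.Properties using (T-∨)
open import Data.Product using (_×_; _,_)
open import Data.Sum using (inj₁; inj₂; swap)
open import Data.Unit using (tt)
open import Data.Empty using (⊥-elim)
open import Function.Base using (id; _∘_)
open import Function.Bundles using (Equivalence)
open import Relation.Nullary using (¬_)
open import Relation.Binary.Definitions using (Symmetric)
open import Relation.Binary.PropositionalEquality using (_≡_; refl; subst)

module _ {V : Set} {E : Rel₂ V} where

  walk-++ : ∀ {n n′ x y z} → Walk E n x y → Walk E n′ y z → Walk E (n + n′) x z
  walk-++ []      w′ = w′
  walk-++ (e ∷ w) w′ = e ∷ walk-++ w w′

  walk-snoc : ∀ {n x y z} → Walk E n x y → E y z → Walk E (suc n) x z
  walk-snoc []       e = e ∷ []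
  walk-snoc (e′ ∷ w) e = e′ ∷ walk-snoc w e

  walk-reverse : Symmetric E → ∀ {n x y} → Walk E n x y → Walk E n y x
  walk-reverse sym []      = []
  walk-reverse sym (e ∷ w) = walk-snoc (walk-reverse sym w) (sym e)

  withinDist-refl : ∀ k {x} → WithinDist E k x x
  withinDist-refl k = 0 , z≤n , []

  withinDist-edge : ∀ k {x y} → E x y → WithinDist E k x y
  withinDist-edge k e = 1 , ^-monoʳ-≤ 2 {0} {k} z≤n , e ∷ []

  withinDist-sym : Symmetric E → ∀ k → Symmetric (WithinDist E k)
  withinDist-sym sym k (n , n≤ , w) = n , n≤ , walk-reverse sym w

  -- 2 ^ suc k unfolds to 2 ^ k + (2 ^ k + 0).
  withinDist-trans-suc : ∀ k {x y z} → WithinDist E k x y → WithinDist E k y z →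
                         WithinDist E (suc k) x z
  withinDist-trans-suc k (n , n≤ , w) (n′ , n′≤ , w′) =
    n + n′ , +-mono-≤ n≤ (≤-trans n′≤ (m≤m+n (2 ^ k) 0)) , walk-++ w w′

module Soundness (F : Fragment) {m : ℕ} (G : Structure m) where
  open Fragment F
  open Structure G using (V)

  private
    T-∨ˡ : ∀ {a b} → T a → T (a ∨ b)
    T-∨ˡ = Equivalence.from T-∨ ∘ inj₁

    T-∨ʳ : ∀ {a b} → T b → T (a ∨ b)
    T-∨ʳ {a} = Equivalence.from (T-∨ {a}) ∘ inj₂

  module _ {E : Rel₂ V}
           (edges⊆E : ∀ {x y} → edges G x y → E x y)
           (E-sym : T hasConv → Symmetric E)
           (one-absent : ¬ T (has1 ∨ has0' ∨ hasCompl)) where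

    ⟦⟧⊆withinDist : ∀ k → (T (hasSlash ∨ hasBacksl) → k ≡ 0) →
                    ∀ e → InC F e → degree e ≤ k →
                    ∀ s t → ⟦ G ⟧ e s t → WithinDist E k s t
    ⟦⟧⊆withinDist k r (name R) i d s t x = withinDist-edge k (edges⊆E (R , x))
    ⟦⟧⊆withinDist k r c1 i d s t x = ⊥-elim (one-absent (T-∨ˡ i))
    ⟦⟧⊆withinDist k r c0' i d s t x = ⊥-elim (one-absent (T-∨ʳ {has1} (T-∨ˡ i)))
    ⟦⟧⊆withinDist k r (compl e) (i , _) d s t x =
      ⊥-elim (one-absent (T-∨ʳ {has1} (T-∨ʳ {has0'} i)))
    ⟦⟧⊆withinDist k r c1' i d s .s refl = withinDist-refl k
    ⟦⟧⊆withinDist k r (e₁ ∪ₑ e₂) (i₁ , i₂) d s t (inj₁ x) =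
      ⟦⟧⊆withinDist k r e₁ i₁ (≤-trans (m≤m⊔n _ _) d) s t x
    ⟦⟧⊆withinDist k r (e₁ ∪ₑ e₂) (i₁ , i₂) d s t (inj₂ x) =
      ⟦⟧⊆withinDist k r e₂ i₂ (≤-trans (m≤n⊔m _ _) d) s t x
    ⟦⟧⊆withinDist k r (e₁ ∩ₑ e₂) (i₁ , i₂) d s t (x , _) =
      ⟦⟧⊆withinDist k r e₁ i₁ (≤-trans (m≤m⊔n _ _) d) s t x
    ⟦⟧⊆withinDist k r (e₁ -ₑ e₂) (_ , i₁ , i₂) d s t (x , _) =
      ⟦⟧⊆withinDist k r e₁ i₁ (≤-trans (m≤m⊔n _ _) d) s t x
    ⟦⟧⊆withinDist (suc k) r (e₁ ∘ₑ e₂) (i₁ , i₂) (s≤s d) s t (v , x , y) =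
      withinDist-trans-suc k
        (⟦⟧⊆withinDist k r′ e₁ i₁ (≤-trans (m≤m⊔n _ _) d) s v x)
        (⟦⟧⊆withinDist k r′ e₂ i₂ (≤-trans (m≤n⊔m _ _) d) v t y)
      where
        r′ : T (hasSlash ∨ hasBacksl) → k ≡ 0
        r′ h with r h
        ... | ()
    ⟦⟧⊆withinDist (suc k) r (e₁ /ₑ e₂) (h , _) d s t x with r (T-∨ˡ h)
    ... | ()
    ⟦⟧⊆withinDist (suc k) r (e₁ ⧵ₑ e₂) (h , _) d s t x with r (T-∨ʳ {hasSlash} h)
    ... | ()
    ⟦⟧⊆withinDist k r (conv e) (h , i) d s t x =
      withinDist-sym (E-sym h) k (⟦⟧⊆withinDist k r e i d t s x)
    ⟦⟧⊆withinDist k r (π₁ₑ e) i d s .s (refl , _) = withinDist-refl k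
    ⟦⟧⊆withinDist k r (π₂ₑ e) i d s .s (refl , _) = withinDist-refl k
    ⟦⟧⊆withinDist k r (π̄₁ₑ e) i d s .s (refl , _) = withinDist-refl k
    ⟦⟧⊆withinDist k r (π̄₂ₑ e) i d s .s (refl , _) = withinDist-refl k

  pathsWithoutOne : ℕ → Rel₂ V
  pathsWithoutOne k = if hasConv then upaths G k else paths G k

  ⟦⟧⊆pathsWithoutOne : ¬ T (has1 ∨ has0' ∨ hasCompl) →
                       ∀ k → (T (hasSlash ∨ hasBacksl) → k ≡ 0) →
                       ∀ e → InC F e → degree e ≤ k →
                       ∀ s t → ⟦ G ⟧ e s t → pathsWithoutOne k s t
  ⟦⟧⊆pathsWithoutOne one-absent with hasConv in conv
  ... | true  = ⟦⟧⊆withinDist inj₁ (λ _ → swap) one-absent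
  ... | false = ⟦⟧⊆withinDist id (λ c → ⊥-elim (subst T conv c)) one-absent

open Fragment
open Soundness

proposition2p7 : (F : Fragment) {m : ℕ} (G : Structure m) (k : ℕ)
    (e : Expr m) → InC F e → degree e ≤ k →
    ∀ s t → ⟦_⟧ G e s t → pathsF G F k s t
proposition2p7 F G k e i d s t x
  with has1 F ∨ has0' F ∨ hasCompl F in one | hasSlash F ∨ hasBacksl F in residuals | k
... | true  | _     | _     = tt
... | false | true  | suc _ = tt
... | false | true  | zero  =
  ⟦⟧⊆pathsWithoutOne F G (subst T one) zero (λ _ → refl) e i d s t x
... | false | false | k′    =
  ⟦⟧⊆pathsWithoutOne F G (subst T one) k′ (λ r → ⊥-elim (subst T residuals r)) e i d s t x
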